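{- Let $S \subseteq \mathbb{Z}$ and $n \in \mathbb{Z}$. If $\{0, 1, \dots, n\} \subseteq \mathrm{diff}(S)$, then $d_p(S) \le \frac{1}{n+1}$.
   Context: For $S \subseteq \mathbb{Z}$ and $a \in \mathbb{Z}$, write $S + a = \{s + a : s \in S\}$. A set $A \subseteq \mathbb{Z}$ is called $S$-packing if for all $a_1, a_2 \in A$ with $a_1 \neq a_2$, the sets $S + a_1$ and $S + a_2$ are disjoint. The difference set of $S$ is $\mathrm{diff}(S) = \{s - t : s, t \in S,\ s \ge t\}$. The upper density of $A \subseteq \mathbb{Z}$ is $\overline{d}(A) = \limsup_{n\to\infty} \frac{|A \cap [-n,n]|}{2n+1}$. The packing density of $S$ is $d_p(S) = \sup\{\overline{d}(A) : A \text{ is } S\text{ -packing}\}$. -}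

module Defs where

open import Level using (0ℓ)
open import Data.Nat as ℕ using (ℕ; suc)
open import Data.Integer as ℤ using (ℤ; +_; -_)
open import Data.Product using (Σ; ∃; ∃-syntax; _×_)
open import Data.List using (List; length)
open import Data.List.Relation.Unary.All using (All)
open import Data.List.Relation.Unary.Unique.Propositional using (Unique)
open import Relation.Nullary using (¬_)
open import Relation.Unary using (Pred; _∈_)
open import Relation.Binary.PropositionalEquality using (_≡_; _≢_)

SetZ : Set₁
SetZ = Pred ℤ 0ℓ

_⊕_ : SetZ → ℤ → SetZ
(S ⊕ a) x = ∃[ s ] (s ∈ S × x ≡ s ℤ.+ a)

IsPacking : SetZ → SetZ → Set
IsPacking S A = ∀ a₁ a₂ → a₁ ∈ A → a₂ ∈ A → a₁ ≢ a₂ →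
                ∀ x → ¬ (x ∈ (S ⊕ a₁) × x ∈ (S ⊕ a₂))

diff : SetZ → SetZ
diff S d = ∃[ s ] ∃[ t ] (s ∈ S × t ∈ S × t ℤ.≤ s × d ≡ s ℤ.- t)

-- L is a list of pairwise distinct elements of A ∩ [-m, m];
-- so |A ∩ [-m,m]| = max length of such a list.
InWindow : SetZ → ℕ → List ℤ → Set
InWindow A m L = Unique L × All (λ a → a ∈ A × (- (+ m)) ℤ.≤ a × a ℤ.≤ + m) L

-- Upper density of A is ≤ p / q  (q > 0):
--   limsup_m |A ∩ [-m,m]| / (2m+1) ≤ p/q
-- unfolded as: for every ε = 1/(k+1) > 0 there is N such that for all m ≥ N,
--   |A ∩ [-m,m]| / (2m+1) ≤ p/q + 1/(k+1),
-- i.e. |A ∩ [-m,m]| · q · (k+1) ≤ (2m+1) · (p·(k+1) + q).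
UpperDensity≤ : SetZ → ℕ → ℕ → Set
UpperDensity≤ A p q =
  ∀ (k : ℕ) → ∃[ N ] ∀ (m : ℕ) → N ℕ.≤ m → ∀ (L : List ℤ) → InWindow A m L →
    length L ℕ.* q ℕ.* suc k ℕ.≤ (2 ℕ.* m ℕ.+ 1) ℕ.* (p ℕ.* suc k ℕ.+ q)

PackingDensity≤ : SetZ → ℕ → ℕ → Set₁
PackingDensity≤ S p q = ∀ (A : SetZ) → IsPacking S A → UpperDensity≤ A p q

-- If 0, 1, …, n all lie in diff(S), two distinct elements of an S-packing
-- set A can never differ by at most n: a₂ − a₁ = s − t with s, t ∈ S would
-- put s + a₁ = t + a₂ in both S + a₁ and S + a₂. So each block of n + 1
-- consecutive integers contains at most one element of A, and the window
-- [−m, m], covered by ⌊2m/(n+1)⌋ + 1 such blocks, contains at most that many.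
module Submission where

open import Defs
open import Data.Nat using (ℕ; suc; _≤_)
open import Data.Integer using (+_)
open import Relation.Unary using (_∈_)

open import Level using (Level)
import Data.Nat as ℕ
import Data.Nat.Properties as ℕ
open import Data.Nat.DivMod using (_/_; _%_; m%n≡m∸m/n*n; m%n<n; m/n*n≤m; /-monoˡ-≤)
import Data.Integer as ℤ
import Data.Integer.Properties as ℤ
import Data.Integer.Tactic.RingSolver as ℤ-Solver
import Data.Nat.Tactic.RingSolver as ℕ-Solver
open import Data.Fin using (Fin; zero; suc; toℕ; fromℕ<)
  renaming (_<_ to _<ᶠ_)
open import Data.Fin.Properties using (pigeonhole; toℕ-fromℕ<)
open import Data.List using (List; []; _∷_; length; lookup)
open import Data.List.Relation.Unary.All as All using (All)
open import Data.List.Relation.Unary.AllPairs using (_∷_)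
open import Data.List.Relation.Unary.Unique.Propositional using (Unique)
open import Data.List.Membership.Propositional.Properties using (∈-lookup)
open import Data.Product using (_×_; _,_)
open import Data.Sum using (inj₁; inj₂)
open import Relation.Nullary using (¬_)
open import Relation.Nullary.Decidable using (decidable-stable)
open import Relation.Binary.PropositionalEquality

private
  variable
    ℓ : Level
    X : Set ℓ

lookup-injective : ∀ {xs : List X} → Unique xs →
                   ∀ i j → i <ᶠ j → lookup xs i ≢ lookup xs j
lookup-injective (x∉xs ∷ _)  zero    (suc j) _         = All.lookup x∉xs (∈-lookup j)
lookup-injective (_ ∷ uniq) (suc i) (suc j) (ℕ.s≤s i<j) = lookup-injective uniq i j i<j

Unique-length≤ : ∀ {P : X → Set ℓ} {xs : List X} {K : ℕ} (f : X → ℕ) →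
                 (∀ {x} → P x → f x ℕ.< K) →
                 (∀ {x y} → P x → P y → f x ≡ f y → x ≡ y) →
                 Unique xs → All P xs → length xs ≤ K
Unique-length≤ {P = P} {xs} {K} f f<K f-injective uniq all-P = ℕ.≮⇒≥ no-collision
  where
  P-at : ∀ i → P (lookup xs i)
  P-at i = All.lookup all-P (∈-lookup i)

  index : Fin (length xs) → Fin K
  index i = fromℕ< (f<K (P-at i))

  no-collision : ¬ (K ℕ.< length xs)
  no-collision K<len with pigeonhole K<len index
  ... | i , j , i<j , same-index = lookup-injective uniq i j i<j
          (f-injective (P-at i) (P-at j)
            (trans (sym (toℕ-fromℕ< _)) (trans (cong toℕ same-index) (toℕ-fromℕ< _))))

/-≡⇒∸< : ∀ x y d .{{_ : ℕ.NonZero d}} → x / d ≡ y / d → y ℕ.∸ x ℕ.< d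
/-≡⇒∸< x y d same-quotient = begin-strict
  y ℕ.∸ x             ≤⟨ ℕ.∸-monoʳ-≤ y (m/n*n≤m x d) ⟩
  y ℕ.∸ x / d ℕ.* d   ≡⟨ cong (λ q → y ℕ.∸ q ℕ.* d) same-quotient ⟩
  y ℕ.∸ y / d ℕ.* d   ≡⟨ m%n≡m∸m/n*n y d ⟨
  y % d               <⟨ m%n<n y d ⟩
  d                   ∎
  where open ℕ.≤-Reasoning

packing-diff⇒≡ : ∀ {S A a₁ a₂} → IsPacking S A → a₁ ∈ A → a₂ ∈ A →
                 a₂ ℤ.- a₁ ∈ diff S → a₁ ≡ a₂
packing-diff⇒≡ {a₁ = a₁} {a₂} packing a₁∈A a₂∈A (s , t , s∈S , t∈S , _ , a₂-a₁≡s-t) =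
  decidable-stable (a₁ ℤ.≟ a₂) λ a₁≢a₂ →
    packing a₁ a₂ a₁∈A a₂∈A a₁≢a₂ (s ℤ.+ a₁) ((s , s∈S , refl) , (t , t∈S , meet))
  where
  meet : s ℤ.+ a₁ ≡ t ℤ.+ a₂
  meet = begin
    s ℤ.+ a₁                           ≡⟨ ℤ-Solver.solve (s ∷ t ∷ a₁ ∷ []) ⟩
    t ℤ.+ ((s ℤ.- t) ℤ.+ a₁)           ≡⟨ cong (λ d → t ℤ.+ (d ℤ.+ a₁)) a₂-a₁≡s-t ⟨
    t ℤ.+ ((a₂ ℤ.- a₁) ℤ.+ a₁)         ≡⟨ ℤ-Solver.solve (t ∷ a₂ ∷ a₁ ∷ []) ⟩
    t ℤ.+ a₂                           ∎
    where open ≡-Reasoning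

offset : ℕ → ℤ.ℤ → ℕ
offset m a = ℤ.∣ a ℤ.+ + m ∣

+offset≡ : ∀ {m a} → ℤ.- + m ℤ.≤ a → + offset m a ≡ a ℤ.+ + m
+offset≡ {m} {a} -m≤a = ℤ.0≤i⇒+∣i∣≡i
  (subst (ℤ._≤ a ℤ.+ + m) (ℤ.+-inverseˡ (+ m)) (ℤ.+-monoˡ-≤ (+ m) -m≤a))

offset≤ : ∀ {m a} → ℤ.- + m ℤ.≤ a → a ℤ.≤ + m → offset m a ≤ m ℕ.+ m
offset≤ {m} -m≤a a≤m = ℤ.drop‿+≤+
  (subst (ℤ._≤ + (m ℕ.+ m)) (sym (+offset≡ -m≤a)) (ℤ.+-monoˡ-≤ (+ m) a≤m))

-‿offset : ∀ {m a₁ a₂} → ℤ.- + m ℤ.≤ a₁ → ℤ.- + m ℤ.≤ a₂ →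
           offset m a₁ ≤ offset m a₂ →
           a₂ ℤ.- a₁ ≡ + (offset m a₂ ℕ.∸ offset m a₁)
-‿offset {m} {a₁} {a₂} -m≤a₁ -m≤a₂ o₁≤o₂ = begin
  a₂ ℤ.- a₁                            ≡⟨ [i+k]-[j+k]≡i-j a₂ a₁ (+ m) ⟨
  (a₂ ℤ.+ + m) ℤ.- (a₁ ℤ.+ + m)        ≡⟨ cong₂ ℤ._-_ (+offset≡ -m≤a₂) (+offset≡ -m≤a₁) ⟨
  + offset m a₂ ℤ.- + offset m a₁      ≡⟨ ℤ.[+m]-[+n]≡m⊖n (offset m a₂) (offset m a₁) ⟩
  offset m a₂ ℤ.⊖ offset m a₁          ≡⟨ ℤ.⊖-≥ o₁≤o₂ ⟩
  + (offset m a₂ ℕ.∸ offset m a₁)      ∎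
  where
  open ≡-Reasoning
  [i+k]-[j+k]≡i-j : ∀ i j k → (i ℤ.+ k) ℤ.- (j ℤ.+ k) ≡ i ℤ.- j
  [i+k]-[j+k]≡i-j = ℤ-Solver.solve-∀

Window : SetZ → ℕ → ℤ.ℤ → Set
Window A m a = a ∈ A × ℤ.- + m ℤ.≤ a × a ℤ.≤ + m

module _ {S : SetZ} {n : ℕ} (0…n⊆diffS : ∀ i → i ≤ n → + i ∈ diff S)
         {A : SetZ} (packing : IsPacking S A) (m : ℕ) where

  block : ℤ.ℤ → ℕ
  block a = offset m a / suc n

  private
    same-block⇒≡ : ∀ {a₁ a₂} → Window A m a₁ → Window A m a₂ →
                   offset m a₁ ≤ offset m a₂ → block a₁ ≡ block a₂ → a₁ ≡ a₂
    same-block⇒≡ {a₁} {a₂} (a₁∈A , -m≤a₁ , _) (a₂∈A , -m≤a₂ , _) o₁≤o₂ same-block =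
      packing-diff⇒≡ packing a₁∈A a₂∈A
        (subst (_∈ diff S) (sym (-‿offset -m≤a₁ -m≤a₂ o₁≤o₂))
          (0…n⊆diffS _ (ℕ.≤-pred (/-≡⇒∸< (offset m a₁) (offset m a₂) (suc n) same-block))))

  block-injective : ∀ {a₁ a₂} → Window A m a₁ → Window A m a₂ →
                    block a₁ ≡ block a₂ → a₁ ≡ a₂
  block-injective {a₁} {a₂} w₁ w₂ same-block with ℕ.≤-total (offset m a₁) (offset m a₂)
  ... | inj₁ o₁≤o₂ = same-block⇒≡ w₁ w₂ o₁≤o₂ same-block
  ... | inj₂ o₂≤o₁ = sym (same-block⇒≡ w₂ w₁ o₂≤o₁ (sym same-block))

  block< : ∀ {a} → Window A m a → block a ℕ.< suc ((m ℕ.+ m) / suc n)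
  block< (_ , -m≤a , a≤m) = ℕ.s≤s (/-monoˡ-≤ (suc n) (offset≤ -m≤a a≤m))

  InWindow⇒length≤ : ∀ {L} → InWindow A m L → length L ≤ suc ((m ℕ.+ m) / suc n)
  InWindow⇒length≤ (uniq , in-window) = Unique-length≤ block block< block-injective uniq in-window

≤suc[/]⇒*≤+ : ∀ {c} x d .{{_ : ℕ.NonZero d}} → c ≤ suc (x / d) → c ℕ.* d ≤ d ℕ.+ x
≤suc[/]⇒*≤+ {c} x d c≤ = begin
  c ℕ.* d                ≤⟨ ℕ.*-monoˡ-≤ d c≤ ⟩
  suc (x / d) ℕ.* d      ≤⟨ ℕ.+-monoʳ-≤ d (m/n*n≤m x d) ⟩
  d ℕ.+ x                ∎
  where open ℕ.≤-Reasoning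

-- For ε = 1/(k+1) the threshold N = k suffices: once m ≥ k, the excess
-- n(k+1) of the count over (2m+1)(k+1) is absorbed by (n+1)(2m+1).
density-bound : ∀ c n m k → k ≤ m → c ℕ.* suc n ≤ suc n ℕ.+ (m ℕ.+ m) →
                c ℕ.* suc n ℕ.* suc k ≤ (2 ℕ.* m ℕ.+ 1) ℕ.* (1 ℕ.* suc k ℕ.+ suc n)
density-bound c n m k k≤m c*d≤ = begin
  c ℕ.* suc n ℕ.* suc k                                   ≤⟨ ℕ.*-monoˡ-≤ (suc k) c*d≤ ⟩
  (suc n ℕ.+ (m ℕ.+ m)) ℕ.* suc k                          ≡⟨ expand n m k ⟩
  (2 ℕ.* m ℕ.+ 1) ℕ.* suc k ℕ.+ n ℕ.* suc k
    ≤⟨ ℕ.+-monoʳ-≤ ((2 ℕ.* m ℕ.+ 1) ℕ.* suc k) (ℕ.*-mono-≤ (ℕ.n≤1+n n) suc-k≤2m+1) ⟩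
  (2 ℕ.* m ℕ.+ 1) ℕ.* suc k ℕ.+ suc n ℕ.* (2 ℕ.* m ℕ.+ 1) ≡⟨ collect n m k ⟩
  (2 ℕ.* m ℕ.+ 1) ℕ.* (1 ℕ.* suc k ℕ.+ suc n)             ∎
  where
  open ℕ.≤-Reasoning
  expand : ∀ n m k → (suc n ℕ.+ (m ℕ.+ m)) ℕ.* suc k
                   ≡ (2 ℕ.* m ℕ.+ 1) ℕ.* suc k ℕ.+ n ℕ.* suc k
  expand = ℕ-Solver.solve-∀
  collect : ∀ n m k → (2 ℕ.* m ℕ.+ 1) ℕ.* suc k ℕ.+ suc n ℕ.* (2 ℕ.* m ℕ.+ 1)
                    ≡ (2 ℕ.* m ℕ.+ 1) ℕ.* (1 ℕ.* suc k ℕ.+ suc n)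
  collect = ℕ-Solver.solve-∀
  suc-k≤2m+1 : suc k ≤ 2 ℕ.* m ℕ.+ 1
  suc-k≤2m+1 = begin
    suc k             ≤⟨ ℕ.s≤s (ℕ.≤-trans k≤m (ℕ.m≤m+n m _)) ⟩
    suc (2 ℕ.* m)     ≡⟨ ℕ.+-comm 1 (2 ℕ.* m) ⟩
    2 ℕ.* m ℕ.+ 1     ∎

proposition2p1 : (S : SetZ) (n : ℕ) →
    (∀ (i : ℕ) → i ≤ n → (+ i) ∈ diff S) →
    PackingDensity≤ S 1 (suc n)
proposition2p1 S n 0…n⊆diffS A packing k = k , λ m k≤m L in-window →
  density-bound (length L) n m k k≤m
    (≤suc[/]⇒*≤+ (m ℕ.+ m) (suc n) (InWindow⇒length≤ 0…n⊆diffS packing m in-window))
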